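{- Let $\theta:\omega\to\omega$ be a bijection and let $S:\omega\to\omega$ be the successor function $S(n)=n+1$. If the function $\theta^{ -1}\circ S\circ\theta$ is computable, then $\theta$ is computable. -}

module Defs where

open import Data.Nat using (ℕ; zero; suc; _<_)
open import Data.Fin using (Fin)
open import Data.Vec using (Vec; []; _∷_; lookup)
open import Data.Product using (∃; _×_; _,_)

-- Codes of partial (μ-)recursive functions of arity n (Kleene).
data PR : ℕ → Set where
  Z    : ∀ {n} → PR n
  S    : PR 1
  P    : ∀ {n} → Fin n → PR n
  C    : ∀ {m n} → PR m → Vec (PR n) m → PR n
  R    : ∀ {n} → PR n → PR (suc (suc n)) → PR (suc n)   -- primitive recursion (on first argument)
  M    : ∀ {n} → PR (suc n) → PR n                      -- unbounded minimisation (on first argument)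

-- Big-step semantics:  f ⟦ xs ⟧⇓ y  means the partial function coded by f
-- is defined at xs with value y.
mutual
  data _⟦_⟧⇓_ : ∀ {n} → PR n → Vec ℕ n → ℕ → Set where
    Z⇓ : ∀ {n} {xs : Vec ℕ n} → Z ⟦ xs ⟧⇓ 0
    S⇓ : ∀ {x} → S ⟦ x ∷ [] ⟧⇓ suc x
    P⇓ : ∀ {n} (i : Fin n) {xs : Vec ℕ n} → P i ⟦ xs ⟧⇓ lookup xs i
    C⇓ : ∀ {m n} {f : PR m} {gs : Vec (PR n) m} {xs : Vec ℕ n} {ys : Vec ℕ m} {y} →
         gs ⟦ xs ⟧⇓* ys → f ⟦ ys ⟧⇓ y → C f gs ⟦ xs ⟧⇓ y
    R0⇓ : ∀ {n} {g : PR n} {h : PR (suc (suc n))} {xs : Vec ℕ n} {y} →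
          g ⟦ xs ⟧⇓ y → R g h ⟦ 0 ∷ xs ⟧⇓ y
    RS⇓ : ∀ {n} {g : PR n} {h : PR (suc (suc n))} {xs : Vec ℕ n} {k r y} →
          R g h ⟦ k ∷ xs ⟧⇓ r → h ⟦ k ∷ r ∷ xs ⟧⇓ y → R g h ⟦ suc k ∷ xs ⟧⇓ y
    M⇓ : ∀ {n} {f : PR (suc n)} {xs : Vec ℕ n} {y} →
         f ⟦ y ∷ xs ⟧⇓ 0 →
         (∀ z → z < y → ∃ λ w → f ⟦ z ∷ xs ⟧⇓ suc w) →
         M f ⟦ xs ⟧⇓ y

  data _⟦_⟧⇓*_ : ∀ {m n} → Vec (PR n) m → Vec ℕ n → Vec ℕ m → Set where
    []⇓ : ∀ {n} {xs : Vec ℕ n} → [] ⟦ xs ⟧⇓* []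
    ∷⇓  : ∀ {m n} {g : PR n} {gs : Vec (PR n) m} {xs : Vec ℕ n} {y ys} →
          g ⟦ xs ⟧⇓ y → gs ⟦ xs ⟧⇓* ys → (g ∷ gs) ⟦ xs ⟧⇓* (y ∷ ys)

Computable : (ℕ → ℕ) → Set
Computable f = ∃ λ (c : PR 1) → ∀ n → c ⟦ n ∷ [] ⟧⇓ f n

-- θ⁻¹ is determined by θ⁻¹ 0 and the conjugate g = θ⁻¹ ∘ S ∘ θ: θ⁻¹ m = gᵐ (θ⁻¹ 0).
-- So θ⁻¹ is obtained from g by primitive recursion, and θ n, the unique and hence
-- least m with θ⁻¹ m = n, is found by unbounded search for a zero of ∣ θ⁻¹ m - n ∣.
module Submission where

open import Defs
open import Data.Empty using (⊥-elim)
open import Data.Fin.Patterns using (0F; 1F)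
open import Data.Nat using (ℕ; zero; suc; pred; _+_; _∸_; _<_; ∣_-_∣)
open import Data.Nat.GeneralisedArithmetic using (fold; +-is-fold)
open import Data.Nat.Properties
  using (+-identityʳ; pred[m∸n]≡m∸[1+n]; m≡n⇒∣m-n∣≡0; ∣m-n∣≡0⇒m≡n; <-irrefl)
open import Data.Product using (∃; _,_)
open import Data.Vec using (Vec; []; _∷_)
open import Function using (_∘_; _↔_; Inverse)
open import Relation.Binary.PropositionalEquality
  using (_≡_; _≢_; _≗_; refl; sym; trans; cong; subst)

constᶜ : ∀ {n} → ℕ → PR n
constᶜ zero    = Z
constᶜ (suc k) = C S (constᶜ k ∷ [])

constᶜ⇓ : ∀ {n} k {xs : Vec ℕ n} → constᶜ k ⟦ xs ⟧⇓ k
constᶜ⇓ zero    = Z⇓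
constᶜ⇓ (suc k) = C⇓ (∷⇓ (constᶜ⇓ k) []⇓) S⇓

foldᶜ : ∀ {n} → PR n → PR 1 → PR (suc n)
foldᶜ base step = R base (C step (P 1F ∷ []))

foldᶜ⇓ : ∀ {n} {base : PR n} {step : PR 1} {xs : Vec ℕ n} {z : ℕ} {s : ℕ → ℕ} →
         base ⟦ xs ⟧⇓ z → (∀ x → step ⟦ x ∷ [] ⟧⇓ s x) →
         ∀ m → foldᶜ base step ⟦ m ∷ xs ⟧⇓ fold z s m
foldᶜ⇓ base⇓ step⇓ zero    = R0⇓ base⇓
foldᶜ⇓ base⇓ step⇓ (suc m) = RS⇓ (foldᶜ⇓ base⇓ step⇓ m) (C⇓ (∷⇓ (P⇓ 1F) []⇓) (step⇓ _))

flipᶜ : PR 2 → PR 2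
flipᶜ f = C f (P 1F ∷ P 0F ∷ [])

flipᶜ⇓ : ∀ {f : PR 2} {m n y} → f ⟦ n ∷ m ∷ [] ⟧⇓ y → flipᶜ f ⟦ m ∷ n ∷ [] ⟧⇓ y
flipᶜ⇓ f⇓ = C⇓ (∷⇓ (P⇓ 1F) (∷⇓ (P⇓ 0F) []⇓)) f⇓

predᶜ : PR 1
predᶜ = R Z (P 0F)

predᶜ⇓ : ∀ n → predᶜ ⟦ n ∷ [] ⟧⇓ pred n
predᶜ⇓ zero    = R0⇓ Z⇓
predᶜ⇓ (suc n) = RS⇓ (predᶜ⇓ n) (P⇓ 0F)

∸-is-fold : ∀ m {n} → fold n pred m ≡ n ∸ m
∸-is-fold zero        = refl
∸-is-fold (suc m) {n} = trans (cong pred (∸-is-fold m)) (pred[m∸n]≡m∸[1+n] n m)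

monusᶜ : PR 2
monusᶜ = foldᶜ (P 0F) predᶜ

monusᶜ⇓ : ∀ m n → monusᶜ ⟦ m ∷ n ∷ [] ⟧⇓ (n ∸ m)
monusᶜ⇓ m n = subst (monusᶜ ⟦ m ∷ n ∷ [] ⟧⇓_) (∸-is-fold m) (foldᶜ⇓ (P⇓ 0F) predᶜ⇓ m)

plusᶜ : PR 2
plusᶜ = foldᶜ (P 0F) S

plusᶜ⇓ : ∀ m n → plusᶜ ⟦ m ∷ n ∷ [] ⟧⇓ (m + n)
plusᶜ⇓ m n = subst (plusᶜ ⟦ m ∷ n ∷ [] ⟧⇓_) (+-is-fold m) (foldᶜ⇓ (P⇓ 0F) (λ _ → S⇓) m)

∣m-n∣≡m∸n+n∸m : ∀ m n → ∣ m - n ∣ ≡ (m ∸ n) + (n ∸ m)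
∣m-n∣≡m∸n+n∸m zero    zero    = refl
∣m-n∣≡m∸n+n∸m zero    (suc n) = refl
∣m-n∣≡m∸n+n∸m (suc m) zero    = sym (+-identityʳ (suc m))
∣m-n∣≡m∸n+n∸m (suc m) (suc n) = ∣m-n∣≡m∸n+n∸m m n

distanceᶜ : PR 2
distanceᶜ = C plusᶜ (flipᶜ monusᶜ ∷ monusᶜ ∷ [])

distanceᶜ⇓ : ∀ m n → distanceᶜ ⟦ m ∷ n ∷ [] ⟧⇓ ∣ m - n ∣
distanceᶜ⇓ m n =
  subst (distanceᶜ ⟦ m ∷ n ∷ [] ⟧⇓_) (sym (∣m-n∣≡m∸n+n∸m m n))
    (C⇓ (∷⇓ (flipᶜ⇓ (monusᶜ⇓ n m)) (∷⇓ (monusᶜ⇓ m n) []⇓)) (plusᶜ⇓ (m ∸ n) (n ∸ m)))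

M⇓-least : ∀ {n} {f : PR (suc n)} {xs : Vec ℕ n} (F : ℕ → ℕ) {y} →
           (∀ z → f ⟦ z ∷ xs ⟧⇓ F z) → F y ≡ 0 → (∀ z → z < y → F z ≢ 0) →
           M f ⟦ xs ⟧⇓ y
M⇓-least {f = f} {xs} F f⇓ Fy≡0 F≢0 =
  M⇓ (subst (f ⟦ _ ∷ xs ⟧⇓_) Fy≡0 (f⇓ _)) (λ z z<y → nonzero (F≢0 z z<y) (f⇓ z))
  where
  nonzero : ∀ {z v} → v ≢ 0 → f ⟦ z ∷ xs ⟧⇓ v → ∃ λ w → f ⟦ z ∷ xs ⟧⇓ suc w
  nonzero {v = zero}  v≢0 _  = ⊥-elim (v≢0 refl)
  nonzero {v = suc w} _   f⇓v = w , f⇓v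

Computable-resp-≗ : ∀ {f g : ℕ → ℕ} → f ≗ g → Computable f → Computable g
Computable-resp-≗ f≗g (c , c⇓) = c , λ n → subst (c ⟦ n ∷ [] ⟧⇓_) (f≗g n) (c⇓ n)

Computable-fold : ∀ {s : ℕ → ℕ} → Computable s → ∀ z → Computable (fold z s)
Computable-fold (c , c⇓) z = foldᶜ (constᶜ z) c , foldᶜ⇓ (constᶜ⇓ z) c⇓

Computable-inverse : (θ : ℕ ↔ ℕ) → Computable (Inverse.from θ) → Computable (Inverse.to θ)
Computable-inverse θ (c , c⇓) =
  M search , λ n → M⇓-least (λ m → ∣ from m - n ∣) (search⇓ n) (hit n) (miss n)
  where
  open Inverse θ
  search : PR 2
  search = C distanceᶜ (C c (P 0F ∷ []) ∷ P 1F ∷ [])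
  search⇓ : ∀ n m → search ⟦ m ∷ n ∷ [] ⟧⇓ ∣ from m - n ∣
  search⇓ n m = C⇓ (∷⇓ (C⇓ (∷⇓ (P⇓ 0F) []⇓) (c⇓ m)) (∷⇓ (P⇓ 1F) []⇓)) (distanceᶜ⇓ (from m) n)
  hit : ∀ n → ∣ from (to n) - n ∣ ≡ 0
  hit n = m≡n⇒∣m-n∣≡0 (strictlyInverseʳ n)
  miss : ∀ n m → m < to n → ∣ from m - n ∣ ≢ 0
  miss n m m<to eq = <-irrefl (trans (sym (strictlyInverseˡ m)) (cong to (∣m-n∣≡0⇒m≡n eq))) m<to

from-is-fold : (θ : ℕ ↔ ℕ) →
               let open Inverse θ in ∀ m → fold (from 0) (from ∘ suc ∘ to) m ≡ from m
from-is-fold θ zero    = refl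
from-is-fold θ (suc m) = cong (from ∘ suc) (trans (cong to (from-is-fold θ m)) (strictlyInverseˡ m))
  where open Inverse θ

lemma2p1 : (θ : ℕ ↔ ℕ) →
    Computable (Inverse.from θ ∘ suc ∘ Inverse.to θ) →
    Computable (Inverse.to θ)
lemma2p1 θ conjugate-computable =
  Computable-inverse θ
    (Computable-resp-≗ (from-is-fold θ) (Computable-fold conjugate-computable (from 0)))
  where open Inverse θ
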